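{- Let $(G',k')$ be the instance output by the kernelization for Diamond-free Edge Deletion (resp. $\{$Diamond, $K_t\}$-free Edge Deletion, $t\ge4$ fixed) and let $X$, $V_X$, $\mathcal{C}$ be as in the context; let $\mathcal{C}_{\ge2}$ be the set of members of $\mathcal{C}$ with at least two vertices. (i) For any two vertices $x,y\in V_X$, let $\mathcal{C}'\subseteq\mathcal{C}_{\ge2}$ be the set of $C$ with $x,y\in A_C$. If $\{x,y\}\in X$ then $|\mathcal{C}'|\le 2k+1$; if $\{x,y\}\notin X$ then $|\mathcal{C}'|\le 1$. (ii) For any ordered pair $(x,y)$ of vertices of $V_X$ that are adjacent in $G'$, let $\mathcal{C}'\subseteq\mathcal{C}_{\ge2}$ be the set of $C$ with $x\in A_C$ and $y\in D_C$. If $\{x,y\}\in X$ then $|\mathcal{C}'|\le 2k+1$; if $\{x,y\}\notin X$ then $|\mathcal{C}'|=0$.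
   Context: A diamond is $K_4$ minus an edge. The problems ask, for $(G,k)$, whether some $F\subseteq E(G)$, $|F|\le k$, makes $G-F$ free of induced diamonds (and, in the second version, of $K_t$). Phase 1: exhaustively apply (Irrelevant edge) delete an edge not contained in any subgraph isomorphic to a forbidden graph; (Sunflower) if $\{x,y\}\in E(G)$ and $G[N(x)\cap N(y)]$ has $k+1$ pairwise vertex-disjoint non-edges, delete $\{x,y\}$ and decrease $k$ by 1; (Vertex-split) if $G[N(v)]$ has components $V_1,\dots,V_t$, $t>1$, replace $v$ by new vertices $v_1,\dots,v_t$ with $N(v_i)=V_i$; (Irrelevant component) delete a connected component with no induced forbidden graph. Greedy packing: starting with $X=\emptyset$, repeatedly add the edges of an induced forbidden graph (diamond; resp. diamond or $K_t$) of $(V(G),E(G)\setminus X)$ to $X$ until none exists; $V_X$ is the set of endpoints of $X$; $\mathcal{C}$ is the set of vertex sets of maximal cliques of $G-V_X$. Kernelization for Diamond-free Edge Deletion: apply Phase 1; greedily pack; if more than $k'$ diamonds are packed declare no-instance, else compute $X,V_X,\mathcal{C}$ and exhaustively apply the clique reduction rule (for $C\in\mathcal{C}$ with $|C|\ge3$, $|C|>4k'$: with $A_C$ the vertices of $V_X$ adjacent to all of $C$ and $C''=\{v\in C: N(v)\subseteq C\cup A_C\}$, delete any $|C''|-1$ vertices of $C''$); here $X,V_X,\mathcal{C}$ are taken as they stand after the last application of clique reduction. Kernelization for $\{$Diamond, $K_t\}$-free Edge Deletion: apply Phase 1 and greedily pack; declare no-instance if more than $k'$ are packed, else output the Phase 1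 result with $X,V_X,\mathcal{C}$ from the packing. For $C\in\mathcal{C}$: $A_C$ is the set of vertices of $V_X$ adjacent to all vertices of $C$; $D_C$ is the set of vertices of $V_X$ adjacent to exactly one vertex of $C$. -}

module Defs where

open import Data.Nat using (ℕ; zero; suc; _+_; _*_; _≤_; _<_)
open import Data.Bool using (Bool; true; false; _∧_; not)
open import Data.Fin using (Fin)
open import Data.Fin.Subset using (Subset; _∈_; _∉_; ∣_∣)
open import Data.Vec using (Vec; lookup)
open import Data.List using (List; length)
open import Data.List.Relation.Unary.All using (All)
open import Data.List.Relation.Unary.Unique.Propositional using (Unique)
open import Data.Product using (Σ; Σ-syntax; _×_; _,_)
open import Data.Sum using (_⊎_)
open import Data.Unit using (⊤)
open import Data.Empty using (⊥)
open import Relation.Nullary using (¬_)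
open import Relation.Binary.PropositionalEquality using (_≡_; _≢_)
open import Function.Definitions using (Injective)
open import Function.Bundles using (_⇔_)

record Graph (n : ℕ) : Set where
  field
    adj    : Fin n → Fin n → Bool
    sym    : ∀ u v → adj u v ≡ adj v u
    irrefl : ∀ v → adj v v ≡ false

open Graph public

Adj : ∀ {n} → Graph n → Fin n → Fin n → Set
Adj G u v = adj G u v ≡ true

SameEdge : ∀ {n} → Fin n → Fin n → Fin n → Fin n → Set
SameEdge u v x y = (u ≡ x × v ≡ y) ⊎ (u ≡ y × v ≡ x)

-- Reachability inside the induced subgraph G[S] (both ends in S)
data Reach {n} (G : Graph n) (S : Fin n → Set) : Fin n → Fin n → Set where
  here : ∀ {u} → S u → Reach G S u u
  step : ∀ {u w v} → S u → Adj G u w → Reach G S w v → Reach G S u v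

data Problem : Set where
  diamondFree   : Problem
  diamondKtFree : ℕ → Problem

-- a subgraph isomorphic to a diamond: vertices a b c d, all edges but cd
-- (cd may or may not be present); distinctness of the pairs other than
-- c,d follows from irreflexivity
record DiamondSub {n} (G : Graph n) : Set where
  constructor dsub
  field
    a b c d : Fin n
    ab : Adj G a b
    ac : Adj G a c
    ad : Adj G a d
    bc : Adj G b c
    bd : Adj G b d
    c≢d : c ≢ d

DiaEdge : ∀ {n} {G : Graph n} → DiamondSub G → Fin n → Fin n → Set
DiaEdge (dsub a b c d _ _ _ _ _ _) x y =
  SameEdge x y a b ⊎ SameEdge x y a c ⊎ SameEdge x y a d
  ⊎ SameEdge x y b c ⊎ SameEdge x y b d

record CliqueSub {n} (G : Graph n) (t : ℕ) : Set where
  constructor ksub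
  field
    f    : Fin t → Fin n
    inj  : Injective _≡_ _≡_ f
    adjs : ∀ i j → i ≢ j → Adj G (f i) (f j)

data ForbSubContains {n} (G : Graph n) (x y : Fin n) : Problem → Set where
  viaDiamond : ∀ {P} (D : DiamondSub G) → DiaEdge D x y → ForbSubContains G x y P
  viaClique  : ∀ {t} (K : CliqueSub G t) →
               Σ[ i ∈ Fin t ] Σ[ j ∈ Fin t ]
                 SameEdge x y (CliqueSub.f K i) (CliqueSub.f K j) →
               ForbSubContains G x y (diamondKtFree t)

data InducedForb {n} (G : Graph n) : Problem → Set where
  indDiamond : ∀ {P} (D : DiamondSub G) →
               ¬ Adj G (DiamondSub.c D) (DiamondSub.d D) → InducedForb G P
  indClique  : ∀ {t} → CliqueSub G t → InducedForb G (diamondKtFree t)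

VertsOf : ∀ {n} {G : Graph n} {P} → InducedForb G P → Fin n → Set
VertsOf (indDiamond (dsub a b c d _ _ _ _ _ _) _) v =
  v ≡ a ⊎ v ≡ b ⊎ v ≡ c ⊎ v ≡ d
VertsOf (indClique (ksub f _ _)) v = Σ[ i ∈ Fin _ ] f i ≡ v

-- Graph operations, stated relationally (results determined up to
-- the choice of vertex numbering)

EdgeDeleted : ∀ {n} → Graph n → Graph n → Fin n → Fin n → Set
EdgeDeleted G H x y =
  ∀ u v → Adj H u v ⇔ (Adj G u v × ¬ SameEdge u v x y)

-- H = G - Del, with ι : V(H) → V(G) the inclusion of the remaining vertices
IsDeletion : ∀ {n m} → Graph n → Graph m → (Fin n → Set) → (Fin m → Fin n) → Set
IsDeletion G H Del ι =
  Injective _≡_ _≡_ ι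
  × (∀ i → ¬ Del (ι i))
  × (∀ w → ¬ Del w → Σ[ i ∈ Fin _ ] ι i ≡ w)
  × (∀ i j → adj H i j ≡ adj G (ι i) (ι j))

-- Vertex-split of v: π : V(H) → V(G) sends each v_i to v and is a
-- bijection elsewhere; rep i is a vertex of the component V_i of G[N(v)]
-- belonging to the copy i.
VertexSplit : ∀ {n m} → Graph n → Fin n → Graph m → Set
VertexSplit {n} {m} G v H =
  Σ[ π ∈ (Fin m → Fin n) ]
    (∀ w → w ≢ v → Σ[ i ∈ Fin m ] (π i ≡ w × (∀ j → π j ≡ w → j ≡ i)))
  × (∀ i j → π i ≢ v → π j ≢ v → Adj H i j ⇔ Adj G (π i) (π j))
  × (∀ i j → π i ≡ v → π j ≡ v → ¬ Adj H i j)
  × (Σ[ rep ∈ (Fin m → Fin n) ]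
       (∀ i → π i ≡ v → Adj G v (rep i))
     × (∀ i j → π i ≡ v → π j ≡ v → i ≢ j → ¬ Reach G (Adj G v) (rep i) (rep j))
     × (∀ w → Adj G v w → Σ[ i ∈ Fin m ] (π i ≡ v × Reach G (Adj G v) (rep i) w))
     × (∀ i j → π i ≡ v → π j ≢ v →
          Adj H i j ⇔ (Adj G v (π j) × Reach G (Adj G v) (rep i) (π j))))

IrrelevantEdge : ∀ {n} → Problem → Graph n → Fin n → Fin n → Set
IrrelevantEdge P G x y = Adj G x y × ¬ ForbSubContains G x y P

CommonNbr : ∀ {n} → Graph n → Fin n → Fin n → Fin n → Set
CommonNbr G x y w = Adj G x w × Adj G y w

-- k pairwise vertex-disjoint non-edges of G[N(x) ∩ N(y)]
DisjointNonEdges : ∀ {n} → Graph n → Fin n → Fin n → ℕ → Set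
DisjointNonEdges {n} G x y k =
  Σ[ a ∈ (Fin k → Fin n) ] Σ[ b ∈ (Fin k → Fin n) ]
    (∀ i → CommonNbr G x y (a i) × CommonNbr G x y (b i)
           × a i ≢ b i × ¬ Adj G (a i) (b i))
  × (∀ i j → i ≢ j → a i ≢ a j × a i ≢ b j × b i ≢ a j × b i ≢ b j)

SunflowerApplies : ∀ {n} → Graph n → ℕ → Fin n → Fin n → Set
SunflowerApplies G k x y = Adj G x y × DisjointNonEdges G x y (suc k)

-- G[N(v)] has more than one connected component
SplitApplies : ∀ {n} → Graph n → Fin n → Set
SplitApplies G v =
  Σ[ w ∈ Fin _ ] Σ[ w' ∈ Fin _ ]
    Adj G v w × Adj G v w' × ¬ Reach G (Adj G v) w w'

Everything : ∀ {n} → Fin n → Set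
Everything _ = ⊤

-- the connected component of v contains no induced forbidden graph
IrrelevantComponent : ∀ {n} → Problem → Graph n → Fin n → Set
IrrelevantComponent P G v =
  ∀ (F : InducedForb G P) → ¬ (∀ u → VertsOf F u → Reach G Everything v u)

data Phase1Step (P : Problem) : ∀ {n m} → Graph n → ℕ → Graph m → ℕ → Set where
  irrEdge   : ∀ {n} {G H : Graph n} {k} x y →
              IrrelevantEdge P G x y → EdgeDeleted G H x y →
              Phase1Step P G k H k
  sunflower : ∀ {n} {G H : Graph n} {k} x y →
              SunflowerApplies G (suc k) x y → EdgeDeleted G H x y →
              Phase1Step P G (suc k) H k
  split     : ∀ {n m} {G : Graph n} {H : Graph m} {k} v →
              SplitApplies G v → VertexSplit G v H →
              Phase1Step P G k H k
  irrComp   : ∀ {n m} {G : Graph n} {H : Graph m} {k} v (ι : Fin m → Fin n) →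
              IrrelevantComponent P G v → IsDeletion G H (Reach G Everything v) ι →
              Phase1Step P G k H k

data Phase1Star (P : Problem) : ∀ {n m} → Graph n → ℕ → Graph m → ℕ → Set where
  stop : ∀ {n} {G : Graph n} {k} → Phase1Star P G k G k
  next : ∀ {n m l} {G : Graph n} {H : Graph m} {K : Graph l} {k k' k''} →
         Phase1Step P G k H k' → Phase1Star P H k' K k'' → Phase1Star P G k K k''

Phase1Exhausted : ∀ {n} → Problem → Graph n → ℕ → Set
Phase1Exhausted P G k =
  (∀ x y → ¬ IrrelevantEdge P G x y)
  × (∀ x y → ¬ SunflowerApplies G k x y)
  × (∀ v → ¬ SplitApplies G v)
  × (∀ v → ¬ IrrelevantComponent P G v)

Phase1 : ∀ {n m} → Problem → Graph n → ℕ → Graph m → ℕ → Set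
Phase1 P G k H k' = Phase1Star P G k H k' × Phase1Exhausted P H k'

-- Greedy packing.  Packing P G m H : m induced forbidden graphs are
-- packed greedily starting from G, and H = (V(G), E(G) \ X) is the
-- final graph, which has no induced forbidden graph.

CopyRemoved : ∀ {n} {P} (G : Graph n) → InducedForb G P → Graph n → Set
CopyRemoved G F H =
  ∀ u v → Adj H u v ⇔ (Adj G u v × ¬ (VertsOf F u × VertsOf F v))

data Packing (P : Problem) {n} : Graph n → ℕ → Graph n → Set where
  done : ∀ {G} → (∀ (F : InducedForb G P) → ⊥) → Packing P G 0 G
  more : ∀ {G H K m} (F : InducedForb G P) → CopyRemoved G F H →
         Packing P H m K → Packing P G (suc m) K

-- X = E(G) \ E(H): the edges of the packed forbidden graphs
XOf : ∀ {n} → Graph n → Graph n → Fin n → Fin n → Bool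
XOf G H u v = adj G u v ∧ not (adj H u v)

InX : ∀ {n} → (Fin n → Fin n → Bool) → Fin n → Fin n → Set
InX X x y = (X x y ≡ true) ⊎ (X y x ≡ true)

InVX : ∀ {n} → (Fin n → Fin n → Bool) → Fin n → Set
InVX X v = Σ[ w ∈ Fin _ ] InX X v w

-- C is (the vertex set of) a maximal clique of G - V_X
MaxCliqueOutside : ∀ {n} → Graph n → (Fin n → Fin n → Bool) → Subset n → Set
MaxCliqueOutside G X C =
  (∀ v → v ∈ C → ¬ InVX X v)
  × (∀ u v → u ∈ C → v ∈ C → u ≢ v → Adj G u v)
  × (∀ w → ¬ InVX X w → w ∉ C → ¬ (∀ c → c ∈ C → Adj G w c))

InA : ∀ {n} → Graph n → (Fin n → Fin n → Bool) → Subset n → Fin n → Set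
InA G X C x = InVX X x × (∀ c → c ∈ C → Adj G x c)

InD : ∀ {n} → Graph n → (Fin n → Fin n → Bool) → Subset n → Fin n → Set
InD G X C y =
  InVX X y × Σ[ c ∈ Fin _ ] (c ∈ C × Adj G y c × (∀ c' → c' ∈ C → Adj G y c' → c' ≡ c))

InC'' : ∀ {n} → Graph n → (Fin n → Fin n → Bool) → Subset n → Fin n → Set
InC'' G X C v = v ∈ C × (∀ w → Adj G v w → (w ∈ C) ⊎ InA G X C w)

-- the rule applies to C, and deleting C'' \ {r} is a valid application
-- (r ≠ r' both in C'', so that |C''| ≥ 2 and the rule changes the graph)
CliqueRuleApplies : ∀ {n} → ℕ → Graph n → (Fin n → Fin n → Bool) → Subset n → Fin n → Fin n → Set
CliqueRuleApplies k' G X C r r' =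
  MaxCliqueOutside G X C × 3 ≤ ∣ C ∣ × 4 * k' < ∣ C ∣
  × InC'' G X C r × InC'' G X C r' × r ≢ r'

data CliqueRedStep (k' : ℕ) : ∀ {n m} → Graph n → (Fin n → Fin n → Bool) →
                                 Graph m → (Fin m → Fin m → Bool) → Set where
  reduce : ∀ {n m} {G : Graph n} {H : Graph m} {X X'} C r r' (ι : Fin m → Fin n) →
           CliqueRuleApplies k' G X C r r' →
           IsDeletion G H (λ v → InC'' G X C v × v ≢ r) ι →
           (∀ i j → X' i j ≡ X (ι i) (ι j)) →
           CliqueRedStep k' G X H X'

data CliqueRedStar (k' : ℕ) : ∀ {n m} → Graph n → (Fin n → Fin n → Bool) →
                                 Graph m → (Fin m → Fin m → Bool) → Set where
  stop : ∀ {n} {G : Graph n} {X} → CliqueRedStar k' G X G X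
  next : ∀ {n m l} {G : Graph n} {H : Graph m} {K : Graph l} {X Y Z} →
         CliqueRedStep k' G X H Y → CliqueRedStar k' H Y K Z → CliqueRedStar k' G X K Z

CliqueRedExhausted : ∀ {n} → ℕ → Graph n → (Fin n → Fin n → Bool) → Set
CliqueRedExhausted k' G X = ∀ C r r' → ¬ CliqueRuleApplies k' G X C r r'

-- Kernel outputs (G', k') together with X (V_X and 𝒞 are derived from
-- G' and X).  Only runs that do not declare a no-instance.

data DFKernel {n₀} (G₀ : Graph n₀) (k₀ : ℕ) :
       ∀ {n} → Graph n → ℕ → (Fin n → Fin n → Bool) → Set where
  run : ∀ {n₁} {G₁ H : Graph n₁} {k₁ m n} {G' : Graph n} {X'} →
        Phase1 diamondFree G₀ k₀ G₁ k₁ →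
        Packing diamondFree G₁ m H → m ≤ k₁ →
        CliqueRedStar k₁ G₁ (XOf G₁ H) G' X' →
        CliqueRedExhausted k₁ G' X' →
        DFKernel G₀ k₀ G' k₁ X'

data DKtKernel (t : ℕ) {n₀} (G₀ : Graph n₀) (k₀ : ℕ) :
       ∀ {n} → Graph n → ℕ → (Fin n → Fin n → Bool) → Set where
  run : ∀ {n₁} {G₁ H : Graph n₁} {k₁ m} →
        Phase1 (diamondKtFree t) G₀ k₀ G₁ k₁ →
        Packing (diamondKtFree t) G₁ m H → m ≤ k₁ →
        DKtKernel t G₀ k₀ G₁ k₁ (XOf G₁ H)

InC≥2 : ∀ {n} → Graph n → (Fin n → Fin n → Bool) → Subset n → Set
InC≥2 G X C = MaxCliqueOutside G X C × 2 ≤ ∣ C ∣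

AtMost : ∀ {n} → ℕ → (Subset n → Set) → Set
AtMost {n} b Q = ∀ (L : List (Subset n)) → Unique L → All Q L → length L ≤ b

Lemma15Conclusion : ∀ {n} → ℕ → Graph n → (Fin n → Fin n → Bool) → Set
Lemma15Conclusion k G X =
  (∀ x y → InVX X x → InVX X y → x ≢ y →
     (InX X x y → AtMost (2 * k + 1) (λ C → InC≥2 G X C × InA G X C x × InA G X C y))
     × (¬ InX X x y → AtMost 1 (λ C → InC≥2 G X C × InA G X C x × InA G X C y)))
  × (∀ x y → InVX X x → InVX X y → Adj G x y →
     (InX X x y → AtMost (2 * k + 1) (λ C → InC≥2 G X C × InA G X C x × InD G X C y))
     × (¬ InX X x y → ∀ C → ¬ (InC≥2 G X C × InA G X C x × InD G X C y)))

module Submission where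

-- Write G − X for G with the packed edges removed. Greedy packing leaves no
-- induced diamond in G − X, and exhaustive Sunflower leaves no k + 1
-- disjoint non-edges in any common neighbourhood; both properties survive
-- deleting vertices (clique reduction) and weakening the budget from k' to
-- k. Every vertex outside V_X is incident to no edge of X, so a diamond
-- with a vertex in some C ∈ 𝒞 lies in G − X. Hence if x is adjacent to
-- all of C, a neighbour of x outside V_X that touches C lies in C, and
-- vertices of two different such cliques are distinct and non-adjacent.
-- Choosing one vertex per clique therefore gives an independent set in
-- N(x) ∩ N(y), which has at most 2k + 1 vertices when xy is an edge.
-- When {x, y} ∉ X, a single diamond rules out the remaining cases.

open import Defs hiding (sym)
open import Data.Nat using (ℕ; zero; suc; _+_; _*_; _≤_; _≤?_; z≤n; s≤s; s≤s⁻¹)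
open import Data.Nat.Properties using (≤-refl; ≤-trans; n≤1+n; +-suc; ≰⇒>)
open import Data.Nat.Tactic.RingSolver using (solve-∀)
open import Data.Fin using (Fin; zero; suc; inject≤) renaming (_≟_ to _≟ᶠ_)
open import Data.Fin.Properties using (any?; suc-injective; inject≤-injective)
open import Data.Fin.Subset using (Subset; _∈_; ∣_∣; _⊆_; inside; outside)
open import Data.Fin.Subset.Properties using (_∈?_; ⊆-antisym)
open import Data.Vec as Vec using (_∷_)
open import Data.Bool using (Bool; true; false; _∧_; not) renaming (_≟_ to _≟ᵇ_)
open import Data.Bool.Properties using (∧-conicalˡ)
open import Data.List using (List; []; _∷_; length)
open import Data.List.Relation.Unary.All as All using (All; []; _∷_)
open import Data.List.Relation.Unary.AllPairs using (AllPairs; []; _∷_)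
open import Data.List.Relation.Unary.Any using (here; there)
open import Data.List.Membership.Propositional using () renaming (_∈_ to _∈ₗ_)
open import Data.List.Relation.Unary.Unique.Propositional using (Unique)
open import Data.Product using (Σ-syntax; ∃-syntax; _×_; _,_; proj₁; proj₂)
open import Data.Sum using (_⊎_; inj₁; inj₂; [_,_])
open import Data.Empty using (⊥; ⊥-elim)
open import Relation.Nullary using (¬_; yes; no)
open import Relation.Nullary.Decidable using (_×-dec_; ¬?; decidable-stable)
open import Relation.Binary.Definitions using (Symmetric)
open import Relation.Binary.PropositionalEquality using (_≡_; _≢_; refl; sym; trans; cong; subst)
open import Function.Definitions using (Injective)
open import Function.Bundles using (Equivalence)

Adj-sym : ∀ {n} (G : Graph n) {u v} → Adj G u v → Adj G v u
Adj-sym G {u} {v} = trans (Graph.sym G v u)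

NonEdge : ∀ {n} → Graph n → Fin n → Fin n → Set
NonEdge G u v = u ≢ v × ¬ Adj G u v

NonEdge-sym : ∀ {n} (G : Graph n) → Symmetric (NonEdge G)
NonEdge-sym G (u≢v , ¬uv) = (λ e → u≢v (sym e)) , (λ vu → ¬uv (Adj-sym G vu))

member : ∀ {n} (p : Subset n) → 1 ≤ ∣ p ∣ → ∃[ u ] u ∈ p
member (inside ∷ p) _ = zero , Vec.here
member (outside ∷ p) h with member p h
... | u , u∈p = suc u , Vec.there u∈p

two-members : ∀ {n} (p : Subset n) → 2 ≤ ∣ p ∣ → ∃[ u ] ∃[ v ] (u ∈ p × v ∈ p × u ≢ v)
two-members (inside ∷ p) (s≤s h) with member p h
... | u , u∈p = zero , suc u , Vec.here , Vec.there u∈p , λ ()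
two-members (outside ∷ p) h with two-members p h
... | u , v , u∈p , v∈p , u≢v =
  suc u , suc v , Vec.there u∈p , Vec.there v∈p , λ e → u≢v (suc-injective e)

missing-neighbour : ∀ {n} (G : Graph n) (C : Subset n) w →
  ¬ (∀ c → c ∈ C → Adj G w c) → ∃[ c ] (c ∈ C × ¬ Adj G w c)
missing-neighbour G C w ¬all with any? (λ c → (c ∈? C) ×-dec ¬? (adj G w c ≟ᵇ true))
... | yes found = found
... | no none = ⊥-elim (¬all λ c c∈C →
        decidable-stable (adj G w c ≟ᵇ true) λ ¬wc → none (c , c∈C , ¬wc))

Pairing : {A : Set} → (A → A → Set) → ℕ → List A → Set
Pairing {A} R m vs =
  Σ[ a ∈ (Fin m → A) ] Σ[ b ∈ (Fin m → A) ]
    (∀ i → a i ∈ₗ vs × b i ∈ₗ vs)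
  × (∀ i → R (a i) (b i))
  × (∀ i j → i ≢ j → R (a i) (a j) × R (a i) (b j) × R (b i) (a j) × R (b i) (b j))

pair-up : ∀ {A : Set} {R : A → A → Set} → Symmetric R →
  ∀ m vs → AllPairs R vs → m + m ≤ length vs → Pairing R m vs
pair-up R-sym zero vs _ _ = (λ ()) , (λ ()) , (λ ()) , (λ ()) , (λ ())
pair-up R-sym (suc m) (u ∷ []) _ (s≤s h) with () ← subst (_≤ 0) (+-suc m m) h
pair-up {R = R} R-sym (suc m) (u ∷ v ∷ rest) ((uv ∷ u-rest) ∷ (v-rest ∷ pairs)) (s≤s h)
  with pair-up R-sym m rest pairs (s≤s⁻¹ (subst (_≤ suc (length rest)) (+-suc m m) h))
... | a′ , b′ , mem′ , within′ , across′ = a , b , mem , within , across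
  where
    a b : Fin (suc m) → _
    a zero = u
    a (suc i) = a′ i
    b zero = v
    b (suc i) = b′ i
    mem : ∀ i → a i ∈ₗ (u ∷ v ∷ rest) × b i ∈ₗ (u ∷ v ∷ rest)
    mem zero = here refl , there (here refl)
    mem (suc i) = there (there (proj₁ (mem′ i))) , there (there (proj₂ (mem′ i)))
    within : ∀ i → R (a i) (b i)
    within zero = uv
    within (suc i) = within′ i
    first : ∀ j → R u (a′ j) × R u (b′ j) × R v (a′ j) × R v (b′ j)
    first j = All.lookup u-rest (proj₁ (mem′ j)) , All.lookup u-rest (proj₂ (mem′ j))
            , All.lookup v-rest (proj₁ (mem′ j)) , All.lookup v-rest (proj₂ (mem′ j))
    across : ∀ i j → i ≢ j → R (a i) (a j) × R (a i) (b j) × R (b i) (a j) × R (b i) (b j)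
    across zero zero i≢j = ⊥-elim (i≢j refl)
    across zero (suc j) _ = first j
    across (suc i) zero _ with first i
    ... | ua , ub , va , vb = R-sym ua , R-sym va , R-sym ub , R-sym vb
    across (suc i) (suc j) i≢j = across′ i j (λ e → i≢j (cong suc e))

length-reduce : ∀ {A B : Set} {P : A → Set} (f : ∀ {x} → P x → B) {xs} (ps : All P xs) →
  length (All.reduce f ps) ≡ length xs
length-reduce f [] = refl
length-reduce f (p ∷ ps) = cong suc (length-reduce f ps)

atMost-via-representatives : ∀ {n b} {A : Set} {Q : Subset n → Set} {P : A → Set} {S : A → A → Set}
  (rep : ∀ {C} → Q C → A) → (∀ {C} (q : Q C) → P (rep q)) →
  (∀ {C C′} (q : Q C) (q′ : Q C′) → C ≢ C′ → S (rep q) (rep q′)) →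
  (∀ vs → All P vs → AllPairs S vs → length vs ≤ b) → AtMost b Q
atMost-via-representatives {b = b} {Q = Q} {P} {S} rep rep-P rep-S bound L unique qs =
  subst (_≤ b) (length-reduce rep qs) (bound (All.reduce rep qs) (all-P qs) (pairs unique qs))
  where
    all-P : ∀ {L} (qs : All Q L) → All P (All.reduce rep qs)
    all-P [] = []
    all-P (q ∷ qs) = rep-P q ∷ all-P qs
    heads : ∀ {C L} → All (C ≢_) L → (q : Q C) (qs : All Q L) → All (S (rep q)) (All.reduce rep qs)
    heads [] q [] = []
    heads (C≢C′ ∷ ≢s) q (q′ ∷ qs) = rep-S q q′ C≢C′ ∷ heads ≢s q qs
    pairs : ∀ {L} → Unique L → (qs : All Q L) → AllPairs S (All.reduce rep qs)
    pairs [] [] = []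
    pairs (≢s ∷ unique) (q ∷ qs) = heads ≢s q qs ∷ pairs unique qs

sunflower-restrict : ∀ {n} {G : Graph n} {k k′ x y} → k′ ≤ k →
  SunflowerApplies G k x y → SunflowerApplies G k′ x y
sunflower-restrict {k = k} {k′} k′≤k (xy , a , b , within , across) =
  xy , (λ i → a (emb i)) , (λ i → b (emb i)) , (λ i → within (emb i))
  , λ i j i≢j → across (emb i) (emb j) (λ e → i≢j (inject≤-injective _ _ i j e))
  where
    emb : Fin (suc k′) → Fin (suc k)
    emb i = inject≤ i (s≤s k′≤k)

sunflower-pullback : ∀ {n m k} {G : Graph n} {H : Graph m} (ι : Fin m → Fin n) →
  Injective _≡_ _≡_ ι → (∀ i j → adj H i j ≡ adj G (ι i) (ι j)) →
  ∀ {x y} → SunflowerApplies H k x y → SunflowerApplies G k (ι x) (ι y)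
sunflower-pullback {G = G} {H} ι ι-inj adj-ι (xy , a , b , within , across) =
  to-G xy , (λ i → ι (a i)) , (λ i → ι (b i))
  , (λ i → let ((xa , ya) , (xb , yb) , a≢b , ¬ab) = within i
           in (to-G xa , to-G ya) , (to-G xb , to-G yb) , ι-≢ a≢b , λ ab → ¬ab (from-G ab))
  , λ i j i≢j → let (aa , ab , ba , bb) = across i j i≢j
                in ι-≢ aa , ι-≢ ab , ι-≢ ba , ι-≢ bb
  where
    to-G : ∀ {i j} → Adj H i j → Adj G (ι i) (ι j)
    to-G {i} {j} = trans (sym (adj-ι i j))
    from-G : ∀ {i j} → Adj G (ι i) (ι j) → Adj H i j
    from-G {i} {j} = trans (adj-ι i j)
    ι-≢ : ∀ {i j} → i ≢ j → ι i ≢ ι j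
    ι-≢ i≢j e = i≢j (ι-inj e)

suc-2k+1≡suc-k+suc-k : ∀ k → suc (2 * k + 1) ≡ suc k + suc k
suc-2k+1≡suc-k+suc-k = solve-∀

pairing-disjointNonEdges : ∀ {n m} {G : Graph n} {x y vs} → All (CommonNbr G x y) vs →
  Pairing (NonEdge G) m vs → DisjointNonEdges G x y m
pairing-disjointNonEdges common (a , b , mem , within , across) =
  a , b
  , (λ i → All.lookup common (proj₁ (mem i)) , All.lookup common (proj₂ (mem i)) , within i)
  , λ i j i≢j → let (aa , ab , ba , bb) = across i j i≢j
                in proj₁ aa , proj₁ ab , proj₁ ba , proj₁ bb

independent-common-neighbours-bound : ∀ {n k} {G : Graph n} {x y} →
  ¬ SunflowerApplies G k x y → Adj G x y →
  ∀ vs → All (CommonNbr G x y) vs → AllPairs (NonEdge G) vs → length vs ≤ 2 * k + 1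
independent-common-neighbours-bound {k = k} {G} no-sunflower xy vs common independent
  with length vs ≤? 2 * k + 1
... | yes fits = fits
... | no ¬fits = ⊥-elim (no-sunflower (xy , pairing-disjointNonEdges {G = G} common
                   (pair-up (NonEdge-sym G) (suc k) vs independent long)))
  where
    long : suc k + suc k ≤ length vs
    long = subst (_≤ length vs) (suc-2k+1≡suc-k+suc-k k) (≰⇒> ¬fits)

KeptEdge : ∀ {n} → Graph n → (Fin n → Fin n → Bool) → Fin n → Fin n → Set
KeptEdge G X u v = Adj G u v × ¬ InX X u v

record KernelInvariant {n} (k : ℕ) (G : Graph n) (X : Fin n → Fin n → Bool) : Set where
  field
    X⊆E : ∀ u v → X u v ≡ true → Adj G u v
    diamond-free : ∀ a b c d → KeptEdge G X a b → KeptEdge G X a c → KeptEdge G X a d →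
                   KeptEdge G X b c → KeptEdge G X b d → c ≢ d → ¬ Adj G c d → ⊥
    sunflower-free : ∀ x y → ¬ SunflowerApplies G k x y

packing-result : ∀ {P n} {G K : Graph n} {m} → Packing P G m K →
  (∀ u v → Adj K u v → Adj G u v) × (InducedForb K P → ⊥)
packing-result (done forb-free) = (λ _ _ uv → uv) , forb-free
packing-result (more F removed rest) with packing-result rest
... | K⊆H , forb-free = (λ u v uv → proj₁ (Equivalence.to (removed u v) (K⊆H u v uv))) , forb-free

invariant-packing : ∀ {P n k m} {G K : Graph n} → Packing P G m K →
  (∀ x y → ¬ SunflowerApplies G k x y) → KernelInvariant k G (XOf G K)
invariant-packing {G = G} {K} packing no-sunflower = record
  { X⊆E = λ u v uv → ∧-conicalˡ (adj G u v) _ uv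
  ; diamond-free = λ a b c d ab ac ad bc bd c≢d ¬cd →
      forb-free (indDiamond (dsub a b c d (in-K ab) (in-K ac) (in-K ad) (in-K bc) (in-K bd) c≢d)
                            (λ cd → ¬cd (K⊆G c d cd)))
  ; sunflower-free = no-sunflower
  }
  where
    K⊆G = proj₁ (packing-result packing)
    forb-free = proj₂ (packing-result packing)
    kept : ∀ g h → g ≡ true → ¬ (g ∧ not h ≡ true) → h ≡ true
    kept true true _ _ = refl
    kept true false _ not-kept = ⊥-elim (not-kept refl)
    in-K : ∀ {u v} → KeptEdge G (XOf G K) u v → Adj K u v
    in-K {u} {v} (uv , ∉X) = kept (adj G u v) (adj K u v) uv (λ e → ∉X (inj₁ e))

invariant-pullback : ∀ {n m k} {G : Graph n} {H : Graph m} {X X′} (ι : Fin m → Fin n) →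
  Injective _≡_ _≡_ ι → (∀ i j → adj H i j ≡ adj G (ι i) (ι j)) →
  (∀ i j → X′ i j ≡ X (ι i) (ι j)) → KernelInvariant k G X → KernelInvariant k H X′
invariant-pullback {G = G} {H} {X} {X′} ι ι-inj adj-ι X-ι I = record
  { X⊆E = λ u v e → trans (adj-ι u v) (X⊆E (ι u) (ι v) (trans (sym (X-ι u v)) e))
  ; diamond-free = λ a b c d ab ac ad bc bd c≢d ¬cd →
      diamond-free (ι a) (ι b) (ι c) (ι d) (kept ab) (kept ac) (kept ad) (kept bc) (kept bd)
                   (λ e → c≢d (ι-inj e)) (λ cd → ¬cd (trans (adj-ι c d) cd))
  ; sunflower-free = λ x y s → sunflower-free (ι x) (ι y) (sunflower-pullback {G = G} {H} ι ι-inj adj-ι s)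
  }
  where
    open KernelInvariant I
    kept : ∀ {i j} → KeptEdge H X′ i j → KeptEdge G X (ι i) (ι j)
    kept {i} {j} (ij , ∉X′) =
      trans (sym (adj-ι i j)) ij
      , [ (λ e → ∉X′ (inj₁ (trans (X-ι i j) e))) , (λ e → ∉X′ (inj₂ (trans (X-ι j i) e))) ]

invariant-clique-reduction : ∀ {k′ n m k} {G : Graph n} {H : Graph m} {X Y} →
  CliqueRedStar k′ G X H Y → KernelInvariant k G X → KernelInvariant k H Y
invariant-clique-reduction stop I = I
invariant-clique-reduction (next (reduce _ _ _ ι _ (ι-inj , _ , _ , adj-ι) X-ι) rest) I =
  invariant-clique-reduction rest (invariant-pullback ι ι-inj adj-ι X-ι I)

invariant-weaken : ∀ {n k k′} {G : Graph n} {X} → k′ ≤ k → KernelInvariant k′ G X → KernelInvariant k G X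
invariant-weaken {G = G} k′≤k I = record
  { X⊆E = X⊆E
  ; diamond-free = diamond-free
  ; sunflower-free = λ x y s → sunflower-free x y (sunflower-restrict {G = G} k′≤k s)
  }
  where open KernelInvariant I

phase1-budget : ∀ {P n m} {G : Graph n} {H : Graph m} {k k′} → Phase1Star P G k H k′ → k′ ≤ k
phase1-budget stop = ≤-refl
phase1-budget (next (irrEdge _ _ _ _) rest) = phase1-budget rest
phase1-budget (next (sunflower _ _ _ _) rest) = ≤-trans (phase1-budget rest) (n≤1+n _)
phase1-budget (next (split _ _ _) rest) = phase1-budget rest
phase1-budget (next (irrComp _ _ _ _) rest) = phase1-budget rest

InAA : ∀ {n} → Graph n → (Fin n → Fin n → Bool) → Fin n → Fin n → Subset n → Set
InAA G X x y C = InC≥2 G X C × InA G X C x × InA G X C y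

InAD : ∀ {n} → Graph n → (Fin n → Fin n → Bool) → Fin n → Fin n → Subset n → Set
InAD G X x y C = InC≥2 G X C × InA G X C x × InD G X C y

module _ {n k} {G : Graph n} {X : Fin n → Fin n → Bool} (I : KernelInvariant k G X) where
  open KernelInvariant I

  kept-into : ∀ {u w} → Adj G u w → ¬ InVX X w → KeptEdge G X u w
  kept-into {u} uw w∉VX = uw , λ e → w∉VX (u , [ inj₂ , inj₁ ] e)

  kept-from : ∀ {u w} → Adj G u w → ¬ InVX X u → KeptEdge G X u w
  kept-from {w = w} uw u∉VX = uw , λ e → u∉VX (w , e)

  Dominates : Fin n → Subset n → Set
  Dominates x C = ∀ c → c ∈ C → Adj G x c

  clique-absorbs : ∀ {C x w c} → MaxCliqueOutside G X C → Dominates x C →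
    ¬ InVX X w → Adj G x w → c ∈ C → Adj G w c → w ∈ C
  clique-absorbs {C} {x} {w} {c} (off , clique , maximal) x→C w∉VX xw c∈C wc with w ∈? C
  ... | yes w∈C = w∈C
  ... | no w∉C with missing-neighbour G C w (maximal w w∉VX w∉C)
  ... | c″ , c″∈C , ¬wc″ = ⊥-elim
    (diamond-free x c w c″ (kept-into (x→C c c∈C) (off c c∈C)) (kept-into xw w∉VX)
      (kept-into (x→C c″ c″∈C) (off c″ c″∈C)) (kept-into (Adj-sym G wc) w∉VX)
      (kept-into (clique c c″ c∈C c″∈C c≢c″) (off c″ c″∈C))
      (λ e → w∉C (subst (_∈ C) (sym e) c″∈C)) ¬wc″)
    where
      c≢c″ : c ≢ c″
      c≢c″ e = ¬wc″ (subst (Adj G w) e wc)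

  overlapping-clique-⊆ : ∀ {C₁ C₂ x c} → MaxCliqueOutside G X C₁ → MaxCliqueOutside G X C₂ →
    Dominates x C₁ → Dominates x C₂ → c ∈ C₁ → c ∈ C₂ → C₂ ⊆ C₁
  overlapping-clique-⊆ {c = c} max₁ (off₂ , clique₂ , _) x→C₁ x→C₂ c∈C₁ c∈C₂ {w} w∈C₂ with w ≟ᶠ c
  ... | yes refl = c∈C₁
  ... | no w≢c = clique-absorbs max₁ x→C₁ (off₂ w w∈C₂) (x→C₂ w w∈C₂) c∈C₁ (clique₂ w c w∈C₂ c∈C₂ w≢c)

  touching-clique-⊆ : ∀ {C₁ C₂ x c₁ c₂} → MaxCliqueOutside G X C₁ → MaxCliqueOutside G X C₂ →
    Dominates x C₁ → Dominates x C₂ → c₁ ∈ C₁ → c₂ ∈ C₂ → c₁ ≡ c₂ ⊎ Adj G c₁ c₂ → C₂ ⊆ C₁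
  touching-clique-⊆ {C₁} max₁ max₂@(off₂ , _) x→C₁ x→C₂ c₁∈C₁ c₂∈C₂ touch =
    overlapping-clique-⊆ max₁ max₂ x→C₁ x→C₂ c₂∈C₁ c₂∈C₂
    where
      c₂∈C₁ : _ ∈ C₁
      c₂∈C₁ = [ (λ e → subst (_∈ C₁) e c₁∈C₁)
              , (λ c₁c₂ → clique-absorbs max₁ x→C₁ (off₂ _ c₂∈C₂) (x→C₂ _ c₂∈C₂) c₁∈C₁ (Adj-sym G c₁c₂))
              ] touch

  distinct-cliques-apart : ∀ {C₁ C₂ x c₁ c₂} → MaxCliqueOutside G X C₁ → MaxCliqueOutside G X C₂ →
    Dominates x C₁ → Dominates x C₂ → C₁ ≢ C₂ → c₁ ∈ C₁ → c₂ ∈ C₂ → NonEdge G c₁ c₂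
  distinct-cliques-apart {C₁} {C₂} {c₁ = c₁} {c₂} max₁ max₂ x→C₁ x→C₂ C₁≢C₂ c₁∈C₁ c₂∈C₂ =
    (λ e → C₁≢C₂ (equal (inj₁ e))) , (λ c₁c₂ → C₁≢C₂ (equal (inj₂ c₁c₂)))
    where
      equal : c₁ ≡ c₂ ⊎ Adj G c₁ c₂ → C₁ ≡ C₂
      equal touch = ⊆-antisym
        (touching-clique-⊆ max₂ max₁ x→C₂ x→C₁ c₂∈C₂ c₁∈C₁ ([ (λ e → inj₁ (sym e)) , (λ a → inj₂ (Adj-sym G a)) ] touch))
        (touching-clique-⊆ max₁ max₂ x→C₁ x→C₂ c₁∈C₁ c₂∈C₂ touch)

  edge-in-X : ∀ {x y} → InX X x y → Adj G x y
  edge-in-X = [ X⊆E _ _ , (λ e → Adj-sym G (X⊆E _ _ e)) ]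

  AA-in-X : ∀ {x y} → InX X x y → AtMost (2 * k + 1) (InAA G X x y)
  AA-in-X {x} {y} xy∈X = atMost-via-representatives rep common apart
    (independent-common-neighbours-bound {G = G} (sunflower-free x y) (edge-in-X xy∈X))
    where
      rep : ∀ {C} → InAA G X x y C → Fin n
      rep {C} ((_ , size) , _) = proj₁ (two-members C size)
      rep∈C : ∀ {C} (q : InAA G X x y C) → rep q ∈ C
      rep∈C {C} ((_ , size) , _) = proj₁ (proj₂ (proj₂ (two-members C size)))
      common : ∀ {C} (q : InAA G X x y C) → CommonNbr G x y (rep q)
      common q@(_ , (_ , x→C) , (_ , y→C)) = x→C _ (rep∈C q) , y→C _ (rep∈C q)
      apart : ∀ {C C′} (q : InAA G X x y C) (q′ : InAA G X x y C′) → C ≢ C′ → NonEdge G (rep q) (rep q′)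
      apart q@((max , _) , (_ , x→C) , _) q′@((max′ , _) , (_ , x→C′) , _) C≢C′ =
        distinct-cliques-apart max max′ x→C x→C′ C≢C′ (rep∈C q) (rep∈C q′)

  -- u and u′ are taken from the two cliques, so x y u u′ is a diamond.
  adjacent-AA-distinct : ∀ {x y C₁ C₂} → Adj G x y → ¬ InX X x y → C₁ ≢ C₂ →
    InAA G X x y C₁ → InAA G X x y C₂ → ⊥
  adjacent-AA-distinct {x} {y} {C₁} {C₂} xy xy∉X C₁≢C₂
    ((max₁@(off₁ , _) , size₁) , (_ , x→C₁) , (_ , y→C₁)) ((max₂@(off₂ , _) , size₂) , (_ , x→C₂) , (_ , y→C₂))
    with two-members C₁ size₁ | two-members C₂ size₂
  ... | u , _ , u∈C₁ , _ | u′ , _ , u′∈C₂ , _ =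
    diamond-free x y u u′ (xy , xy∉X)
      (kept-into (x→C₁ u u∈C₁) (off₁ u u∈C₁)) (kept-into (x→C₂ u′ u′∈C₂) (off₂ u′ u′∈C₂))
      (kept-into (y→C₁ u u∈C₁) (off₁ u u∈C₁)) (kept-into (y→C₂ u′ u′∈C₂) (off₂ u′ u′∈C₂))
      u≢u′ ¬uu′
    where
      u≢u′ : u ≢ u′
      u≢u′ = proj₁ (distinct-cliques-apart max₁ max₂ x→C₁ x→C₂ C₁≢C₂ u∈C₁ u′∈C₂)
      ¬uu′ : ¬ Adj G u u′
      ¬uu′ = proj₂ (distinct-cliques-apart max₁ max₂ x→C₁ x→C₂ C₁≢C₂ u∈C₁ u′∈C₂)

  -- u, v ∈ C form a diamond with the non-adjacent pair x, y.
  nonadjacent-not-AA : ∀ {x y C} → x ≢ y → ¬ Adj G x y → ¬ InAA G X x y C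
  nonadjacent-not-AA {x} {y} {C} x≢y ¬xy (((off , clique , _) , size) , (_ , x→C) , (_ , y→C))
    with two-members C size
  ... | u , v , u∈C , v∈C , u≢v =
    diamond-free u v x y (kept-from (clique u v u∈C v∈C u≢v) (off u u∈C))
      (kept-from (Adj-sym G (x→C u u∈C)) (off u u∈C)) (kept-from (Adj-sym G (y→C u u∈C)) (off u u∈C))
      (kept-from (Adj-sym G (x→C v v∈C)) (off v v∈C)) (kept-from (Adj-sym G (y→C v v∈C)) (off v v∈C))
      x≢y ¬xy

  AA-not-in-X : ∀ {x y} → x ≢ y → ¬ InX X x y → AtMost 1 (InAA G X x y)
  AA-not-in-X x≢y xy∉X [] _ _ = z≤n
  AA-not-in-X x≢y xy∉X (_ ∷ []) _ _ = s≤s z≤n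
  AA-not-in-X {x} {y} x≢y xy∉X (_ ∷ _ ∷ _) ((C₁≢C₂ ∷ _) ∷ _) (q₁ ∷ q₂ ∷ _) with adj G x y ≟ᵇ true
  ... | yes xy = ⊥-elim (adjacent-AA-distinct xy xy∉X C₁≢C₂ q₁ q₂)
  ... | no ¬xy = ⊥-elim (nonadjacent-not-AA x≢y ¬xy q₁)

  AD-in-X : ∀ {x y} → InX X x y → AtMost (2 * k + 1) (InAD G X x y)
  AD-in-X {x} {y} xy∈X = atMost-via-representatives rep common apart
    (independent-common-neighbours-bound {G = G} (sunflower-free x y) (edge-in-X xy∈X))
    where
      rep : ∀ {C} → InAD G X x y C → Fin n
      rep (_ , _ , (_ , c , _)) = c
      common : ∀ {C} (q : InAD G X x y C) → CommonNbr G x y (rep q)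
      common (_ , (_ , x→C) , (_ , c , c∈C , yc , _)) = x→C c c∈C , yc
      apart : ∀ {C C′} (q : InAD G X x y C) (q′ : InAD G X x y C′) → C ≢ C′ → NonEdge G (rep q) (rep q′)
      apart ((max , _) , (_ , x→C) , (_ , _ , c∈C , _)) ((max′ , _) , (_ , x→C′) , (_ , _ , c′∈C′ , _)) C≢C′ =
        distinct-cliques-apart max max′ x→C x→C′ C≢C′ c∈C c′∈C′

  -- With c the neighbour of y in C and c′ ∈ C another vertex, x c y c′ is a diamond.
  AD-not-in-X : ∀ {x y} → InVX X y → Adj G x y → ¬ InX X x y → ∀ C → ¬ InAD G X x y C
  AD-not-in-X {x} {y} y∈VX xy xy∉X C (((off , clique , _) , size) , (_ , x→C) , (_ , c , c∈C , yc , only-c))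
    with other-member (two-members C size)
    where
      other-member : ∃[ u ] ∃[ v ] (u ∈ C × v ∈ C × u ≢ v) → ∃[ c′ ] (c′ ∈ C × c′ ≢ c)
      other-member (u , v , u∈C , v∈C , u≢v) with u ≟ᶠ c
      ... | yes refl = v , v∈C , λ e → u≢v (sym e)
      ... | no u≢c = u , u∈C , u≢c
  ... | c′ , c′∈C , c′≢c =
    diamond-free x c y c′ (kept-into (x→C c c∈C) (off c c∈C)) (xy , xy∉X)
      (kept-into (x→C c′ c′∈C) (off c′ c′∈C)) (kept-from (Adj-sym G yc) (off c c∈C))
      (kept-into (clique c c′ c∈C c′∈C (λ e → c′≢c (sym e))) (off c′ c′∈C))
      (λ e → off c′ c′∈C (subst (InVX X) e y∈VX))
      (λ yc′ → c′≢c (only-c c′ c′∈C yc′))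

  conclusion : Lemma15Conclusion k G X
  conclusion =
    (λ x y _ _ x≢y → AA-in-X , AA-not-in-X x≢y)
    , (λ x y _ y∈VX xy → AD-in-X , AD-not-in-X y∈VX xy)

lemma15 : (∀ {n₀} (G₀ : Graph n₀) (k : ℕ) {n} (G' : Graph n) (k' : ℕ) (X : Fin n → Fin n → Bool) →
            DFKernel G₀ k G' k' X → Lemma15Conclusion k G' X)
          × (∀ (t : ℕ) → 4 ≤ t → ∀ {n₀} (G₀ : Graph n₀) (k : ℕ) {n} (G' : Graph n) (k' : ℕ) (X : Fin n → Fin n → Bool) →
            DKtKernel t G₀ k G' k' X → Lemma15Conclusion k G' X)
lemma15 =
  (λ { _ _ _ _ _ (run (phase1 , exhausted) packing _ reduction _) →
         conclusion (invariant-weaken (phase1-budget phase1)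
           (invariant-clique-reduction reduction (invariant-packing packing (proj₁ (proj₂ exhausted))))) })
  , (λ { _ _ _ _ _ _ _ (run (phase1 , exhausted) packing _) →
         conclusion (invariant-weaken (phase1-budget phase1)
           (invariant-packing packing (proj₁ (proj₂ exhausted)))) })
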